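{- For every $k\geq 1$, the Grundy number of the binomial tree $T_k$ is $k$. Moreover, there are exactly two Grundy colorings of $T_k$ achieving color $k$, and exactly one Grundy coloring achieving color $k$ in which the root is colored $k$.
   Context: For rooted trees $t_1,\dots,t_l$ with roots $v_1,\dots,v_l$, $v[t_1,\dots,t_l]$ denotes the tree rooted at a new vertex $v$ obtained from the disjoint union of the $t_i$ by joining $v$ to every $v_i$; $v_i$ is called the $i$-th child of $v$. Binomial trees: $T_1$ is a single vertex (the root), and $T_{k+1}=v[T_1,T_2,\dots,T_k]$. A $k$-coloring of $G$ is a surjective map $\varphi:V(G)\to\{1,\dots,k\}$. Given an ordering $v_1,\dots,v_n$ of $V(G)$, $\varphi$ is first-fit with respect to it if for each $v_i$ and each $c<\varphi(v_i)$, $v_i$ has a neighbor $v_j$, $j<i$, with $\varphi(v_j)=c$. A Grundy coloring is a proper coloring that is first-fit with respect to some ordering; the Grundy number is the maximum number of colors of a Grundy coloring. A Grundy coloring achieving color $k$ is a Grundy coloring using colors $1,\dots,k$. -}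

module Defs where

open import Data.Nat using (ℕ; zero; suc; _≤_; _<_)
open import Data.Fin using (Fin; toℕ)
open import Data.Product using (Σ; ∃; _×_; _,_)
open import Data.Sum using (_⊎_)
open import Relation.Binary.PropositionalEquality using (_≡_; _≢_)
open import Function.Definitions using (Injective)

-- T_{k+1} = v[T_1, ..., T_k]: a vertex of T_{k+1} is either the new root v,
-- or a vertex of the i-th subtree T_{i+1} (i : Fin k, 0-indexed).
-- Vtx 0 is empty (there is no T_0).
data Vtx : ℕ → Set where
  root : ∀ {k} → Vtx (suc k)
  sub  : ∀ {k} (i : Fin k) → Vtx (suc (toℕ i)) → Vtx (suc k)

data Adj : ∀ {k} → Vtx k → Vtx k → Set where
  down   : ∀ {k} {i : Fin k} → Adj {suc k} root (sub i root)
  up     : ∀ {k} {i : Fin k} → Adj {suc k} (sub i root) root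
  inside : ∀ {k} {i : Fin k} {u v : Vtx (suc (toℕ i))} →
           Adj u v → Adj {suc k} (sub i u) (sub i v)

IsColoring : ∀ {k} → ℕ → (Vtx k → ℕ) → Set
IsColoring {k} c φ =
  (∀ v → 1 ≤ φ v × φ v ≤ c) ×
  (∀ j → 1 ≤ j → j ≤ c → ∃ λ (v : Vtx k) → φ v ≡ j)

Proper : ∀ {k} → (Vtx k → ℕ) → Set
Proper {k} φ = ∀ (u v : Vtx k) → Adj u v → φ u ≢ φ v

-- An ordering of V(T_k) is given by an injective rank function pos
-- (u comes before v iff pos u < pos v).
IsOrdering : ∀ {k} → (Vtx k → ℕ) → Set
IsOrdering pos = Injective _≡_ _≡_ pos

FirstFit : ∀ {k} → (Vtx k → ℕ) → (Vtx k → ℕ) → Set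
FirstFit {k} pos φ =
  ∀ (v : Vtx k) (c : ℕ) → 1 ≤ c → c < φ v →
    ∃ λ (u : Vtx k) → Adj v u × pos u < pos v × φ u ≡ c

Grundy : ∀ {k} → ℕ → (Vtx k → ℕ) → Set
Grundy {k} c φ =
  IsColoring c φ × Proper φ ×
  (∃ λ (pos : Vtx k → ℕ) → IsOrdering pos × FirstFit pos φ)

GrundyNumberIs : ℕ → ℕ → Set
GrundyNumberIs k g =
  (∃ λ (φ : Vtx k → ℕ) → Grundy g φ) ×
  (∀ (c : ℕ) (φ : Vtx k → ℕ) → Grundy c φ → c ≤ g)

SameColoring : ∀ {k} → (Vtx k → ℕ) → (Vtx k → ℕ) → Set
SameColoring {k} φ ψ = ∀ (v : Vtx k) → φ v ≡ ψ v

ExactlyTwo : ∀ {k} → ((Vtx k → ℕ) → Set) → Set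
ExactlyTwo {k} P =
  Σ (Vtx k → ℕ) λ φ₁ → Σ (Vtx k → ℕ) λ φ₂ →
    P φ₁ × P φ₂ × (∃ λ (v : Vtx k) → φ₁ v ≢ φ₂ v) ×
    (∀ ψ → P ψ → SameColoring ψ φ₁ ⊎ SameColoring ψ φ₂)

ExactlyOne : ∀ {k} → ((Vtx k → ℕ) → Set) → Set
ExactlyOne {k} P =
  Σ (Vtx k → ℕ) λ φ → P φ × (∀ ψ → P ψ → SameColoring ψ φ)

-- A Grundy coloring is a proper coloring in which every vertex of color c
-- sees all colors below c; conversely such a coloring is first-fit for the
-- order by color. So a vertex with r children gets color at most r + 1, or
-- r + 2 if it also uses its parent. In T_k the root has k - 1 children and
-- the root of the subtree T_{j+1} has j, which bounds every color by k.
-- If the root has color k, its children carry 1, …, k - 1 while the child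
-- with j children can take at most j + 1, so filling the colors from the top
-- down pins child j to color j + 1; recursively the coloring is canonical.
-- Otherwise color k sits on the root of the last subtree T_{k-1}, which must
-- then use its parent for color k - 1: the coloring is the canonical one of
-- T_k seen as two copies of T_{k-1} with their roots joined, roles exchanged.

module Submission where

open import Defs
open import Data.Nat
  using (ℕ; zero; suc; _+_; _*_; _^_; _≤_; _<_; z≤n; s≤s; z<s; _≟_; _≤?_)
open import Data.Nat.Properties
open import Data.Fin using (Fin; zero; suc; toℕ; fromℕ; fromℕ<)
open import Data.Fin.Properties
  using (toℕ<n; toℕ-injective; toℕ-fromℕ; toℕ-fromℕ<; injective⇒≤)
open import Data.Product using (∃; _×_; _,_; proj₁; proj₂)
open import Data.Sum using (_⊎_; inj₁; inj₂)
open import Data.Empty using (⊥-elim)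
open import Relation.Nullary using (yes; no)
open import Relation.Binary using (tri<; tri≈; tri>)
open import Relation.Binary.PropositionalEquality
open import Function.Definitions using (Injective)

Coloring : ℕ → Set
Coloring d = Vtx (suc d) → ℕ

Greedy : ∀ {k} → (Vtx k → ℕ) → Set
Greedy {k} φ = ∀ v c → 1 ≤ c → c < φ v → ∃ λ (x : Vtx k) → Adj v x × φ x ≡ c

-- The shape of a greedy coloring restricted to a subtree: its root may
-- also rely on the color p of its parent, which lies outside.
GreedyBelow : ∀ {d} → ℕ → Coloring d → Set
GreedyBelow {d} p ψ = ∀ v c → 1 ≤ c → c < ψ v →
  (∃ λ (x : Vtx (suc d)) → Adj v x × ψ x ≡ c) ⊎ (v ≡ root × c ≡ p)

private variable
  d p : ℕ

greedy⇒greedyBelow : ∀ {ψ : Coloring d} → Greedy ψ → GreedyBelow p ψ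
greedy⇒greedyBelow h v c 1≤c c<ψv = inj₁ (h v c 1≤c c<ψv)

greedyBelow⇒greedy : ∀ {ψ : Coloring d} → ψ root ≤ p → GreedyBelow p ψ → Greedy ψ
greedyBelow⇒greedy ψr≤p h v c 1≤c c<ψv with h v c 1≤c c<ψv
... | inj₁ neighbour = neighbour
... | inj₂ (refl , refl) = ⊥-elim (<⇒≱ c<ψv ψr≤p)

greedyBelow-sub : ∀ {ψ : Coloring d} → GreedyBelow p ψ → (j : Fin d) →
                  GreedyBelow (ψ root) (λ w → ψ (sub j w))
greedyBelow-sub h j w c 1≤c c<ψw with h (sub j w) c 1≤c c<ψw
... | inj₁ (_ , up , e) = inj₂ (refl , sym e)
... | inj₁ (sub _ x , inside a , e) = inj₁ (x , a , e)

greedy-from-subtrees : ∀ {ψ : Coloring d} →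
  (∀ c → 1 ≤ c → c < ψ root → ∃ λ j → ψ (sub j root) ≡ c) →
  (∀ j → GreedyBelow (ψ root) (λ w → ψ (sub j w))) → Greedy ψ
greedy-from-subtrees children _ root c 1≤c c<ψr with children c 1≤c c<ψr
... | j , e = sub j root , down , e
greedy-from-subtrees _ subtrees (sub j w) c 1≤c c<ψw with subtrees j w c 1≤c c<ψw
... | inj₁ (x , a , e) = sub j x , inside a , e
... | inj₂ (refl , refl) = root , up , refl

greedyBelow⇒sub-greedy : ∀ {ψ : Coloring d} → GreedyBelow p ψ → (j : Fin d) →
                         ψ (sub j root) ≤ ψ root → Greedy (λ w → ψ (sub j w))
greedyBelow⇒sub-greedy h j ψj≤ψr = greedyBelow⇒greedy ψj≤ψr (greedyBelow-sub h j)

covered⇒≤ : ∀ {n} (col : Fin n → ℕ) s →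
            (∀ c → 1 ≤ c → c < s → ∃ λ i → col i ≡ c) → s ≤ suc n
covered⇒≤ col zero _ = z≤n
covered⇒≤ col (suc r) covered =
  s≤s (injective⇒≤ {f = λ c → proj₁ (witness c)} injective)
  where
  witness : (c : Fin r) → ∃ λ i → col i ≡ suc (toℕ c)
  witness c = covered (suc (toℕ c)) (s≤s z≤n) (s≤s (toℕ<n c))
  injective : Injective _≡_ _≡_ (λ c → proj₁ (witness c))
  injective {c} {c′} eq = toℕ-injective (suc-injective (begin
    suc (toℕ c)              ≡⟨ proj₂ (witness c) ⟨
    col (proj₁ (witness c))  ≡⟨ cong col eq ⟩
    col (proj₁ (witness c′)) ≡⟨ proj₂ (witness c′) ⟩
    suc (toℕ c′)             ∎))
    where open ≡-Reasoning

greedy-root-≤ : ∀ {ψ : Coloring d} → Greedy ψ → ψ root ≤ suc d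
greedy-root-≤ {ψ = ψ} h = covered⇒≤ (λ j → ψ (sub j root)) (ψ root) children
  where
  children : ∀ c → 1 ≤ c → c < ψ root → ∃ λ j → ψ (sub j root) ≡ c
  children c 1≤c c<ψr with h root c 1≤c c<ψr
  ... | _ , down {i = j} , e = j , e

greedyBelow-root-≤ : ∀ {ψ : Coloring d} → GreedyBelow p ψ → ψ root ≤ suc (suc d)
greedyBelow-root-≤ {d = d} {p = p} {ψ} h = covered⇒≤ neighbour (ψ root) neighbours
  where
  neighbour : Fin (suc d) → ℕ
  neighbour zero = p
  neighbour (suc j) = ψ (sub j root)
  neighbours : ∀ c → 1 ≤ c → c < ψ root → ∃ λ i → neighbour i ≡ c
  neighbours c 1≤c c<ψr with h root c 1≤c c<ψr
  ... | inj₁ (_ , down {i = j} , e) = suc j , e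
  ... | inj₂ (_ , e) = zero , sym e

greedyBelow-≤ : ∀ {ψ : Coloring d} → GreedyBelow p ψ → ∀ v → ψ v ≤ suc (suc d)
greedyBelow-sub-≤ : ∀ {ψ : Coloring d} → GreedyBelow p ψ → ∀ j w →
                    ψ (sub j w) ≤ suc d

greedyBelow-≤ h root = greedyBelow-root-≤ h
greedyBelow-≤ h (sub j w) = m≤n⇒m≤1+n (greedyBelow-sub-≤ h j w)

greedyBelow-sub-≤ h j w =
  ≤-trans (greedyBelow-≤ (greedyBelow-sub h j) w) (s≤s (toℕ<n j))

greedy-≤ : ∀ {ψ : Coloring d} → Greedy ψ → ∀ v → ψ v ≤ suc d
greedy-≤ h root = greedy-root-≤ h
greedy-≤ h (sub j w) = greedyBelow-sub-≤ (greedy⇒greedyBelow {p = 0} h) j w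

greedyBelow-child-≤ : ∀ {ψ : Coloring d} → GreedyBelow p ψ → (j : Fin d) →
                      ψ (sub j root) ≤ ψ root → ψ (sub j root) ≤ suc (toℕ j)
greedyBelow-child-≤ h j ψj≤ψr = greedy-root-≤ (greedyBelow⇒sub-greedy h j ψj≤ψr)

-- Color suc j can only sit at an index ≥ j; filling the colors from r
-- downwards pins each one to its own index.
staircase : ∀ {n} (col : Fin n → ℕ) r →
            (∀ j → col j ≤ r → col j ≤ suc (toℕ j)) →
            (∀ c → 1 ≤ c → c ≤ r → ∃ λ j → toℕ j < r × col j ≡ c) →
            ∀ j → toℕ j < r → col j ≡ suc (toℕ j)
staircase col r bounded covered j j<r = descend r j j<r (m≤m+n r (toℕ j))
  where
  index-≥ : ∀ i {c} → col i ≡ suc c → c < r → c ≤ toℕ i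
  index-≥ i coli≡1+c c<r = ≤-pred (subst (_≤ suc (toℕ i)) coli≡1+c
                                     (bounded i (subst (_≤ r) (sym coli≡1+c) c<r)))
  descend : ∀ k j → toℕ j < r → r ≤ k + toℕ j → col j ≡ suc (toℕ j)
  descend zero j j<r r≤j = ⊥-elim (<⇒≱ j<r r≤j)
  descend (suc k) j j<r r≤k+1+j with covered (suc (toℕ j)) (s≤s z≤n) j<r
  ... | i , i<r , coli≡1+j with m≤n⇒m<n∨m≡n (index-≥ i coli≡1+j j<r)
  ...   | inj₁ j<i = ⊥-elim (<⇒≢ j<i (suc-injective (trans (sym coli≡1+j) coli≡1+i)))
    where
    coli≡1+i : col i ≡ suc (toℕ i)
    coli≡1+i = descend k i i<r
      (≤-trans r≤k+1+j (subst (_≤ k + toℕ i) (+-suc k (toℕ j)) (+-monoʳ-≤ k j<i)))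
  ...   | inj₂ j≡i with toℕ-injective j≡i
  ...     | refl = coli≡1+j

greedyBelow-children : ∀ {ψ : Coloring d} → GreedyBelow p ψ → ∀ r → r < ψ root →
                       (∀ c → 1 ≤ c → c ≤ r → c ≢ p) →
                       (∀ j → r ≤ toℕ j → r < ψ (sub j root)) →
                       ∀ j → toℕ j < r → ψ (sub j root) ≡ suc (toℕ j)
greedyBelow-children {ψ = ψ} h r r<ψr parent≰r children≰r =
  staircase (λ j → ψ (sub j root)) r
    (λ j ψj≤r → greedyBelow-child-≤ h j (≤-trans ψj≤r (<⇒≤ r<ψr))) covered
  where
  covered : ∀ c → 1 ≤ c → c ≤ r → ∃ λ j → toℕ j < r × ψ (sub j root) ≡ c
  covered c 1≤c c≤r with h root c 1≤c (≤-<-trans c≤r r<ψr)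
  ... | inj₂ (_ , c≡p) = ⊥-elim (parent≰r c 1≤c c≤r c≡p)
  ... | inj₁ (_ , down {i = j} , e) = j , j<r , e
    where
    j<r : toℕ j < r
    j<r = ≰⇒> (λ r≤j → <⇒≱ (children≰r j r≤j) (subst (_≤ r) (sym e) c≤r))

-- canonical colors every vertex with one more than its number of children.
withRoot : ℕ → Coloring d
withRoot x root = x
withRoot x (sub j w) = withRoot (suc (toℕ j)) w

canonical : Coloring d
canonical {d} = withRoot (suc d)

greedy-canonical : ∀ {ψ : Coloring d} → Greedy ψ → ψ root ≡ suc d →
                   SameColoring ψ canonical
greedyBelow-sub-canonical : ∀ {ψ : Coloring d} → GreedyBelow p ψ → (j : Fin d) →
                            ψ (sub j root) ≡ suc (toℕ j) → suc (toℕ j) ≤ ψ root →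
                            ∀ w → ψ (sub j w) ≡ canonical w

greedy-canonical h ψr≡1+d root = ψr≡1+d
greedy-canonical {d = d} {ψ} h ψr≡1+d (sub j w) =
  greedyBelow-sub-canonical h₀ j (children j (toℕ<n j))
    (subst (suc (toℕ j) ≤_) (sym ψr≡1+d) (s≤s (<⇒≤ (toℕ<n j)))) w
  where
  h₀ : GreedyBelow 0 ψ
  h₀ = greedy⇒greedyBelow h
  children : ∀ j → toℕ j < d → ψ (sub j root) ≡ suc (toℕ j)
  children = greedyBelow-children h₀ d (subst (d <_) (sym ψr≡1+d) ≤-refl)
    (λ _ 1≤c _ → >⇒≢ 1≤c) (λ j d≤j → ⊥-elim (<⇒≱ (toℕ<n j) d≤j))

greedyBelow-sub-canonical {ψ = ψ} h j ψj≡1+j 1+j≤ψr w =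
  greedy-canonical (greedyBelow⇒sub-greedy h j (subst (_≤ ψ root) (sym ψj≡1+j) 1+j≤ψr))
                   ψj≡1+j w

greedyBelow-root-max : ∀ {ψ : Coloring d} → GreedyBelow p ψ → ψ root ≡ suc (suc d) →
                       p ≡ suc d × SameColoring ψ (withRoot (suc (suc d)))
greedyBelow-root-max {d = d} {p = p} {ψ} h ψr≡2+d = p≡1+d , fromChildren
  where
  ψj≤ψr : ∀ j → ψ (sub j root) ≤ ψ root
  ψj≤ψr j = subst (ψ (sub j root) ≤_) (sym ψr≡2+d)
                  (m≤n⇒m≤1+n (greedyBelow-sub-≤ h j root))
  children-≤ : ∀ j → ψ (sub j root) ≤ d
  children-≤ j = ≤-trans (greedyBelow-child-≤ h j (ψj≤ψr j)) (toℕ<n j)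
  below-root : ∀ {c} → c ≤ suc d → c < ψ root
  below-root c≤1+d = subst (_ <_) (sym ψr≡2+d) (s≤s c≤1+d)
  p≡1+d : p ≡ suc d
  p≡1+d with h root (suc d) (s≤s z≤n) (below-root ≤-refl)
  ... | inj₁ (_ , down {i = j} , e) =
    ⊥-elim (<⇒≱ (s≤s (children-≤ j)) (≤-reflexive (sym e)))
  ... | inj₂ (_ , e) = sym e
  children : ∀ j → toℕ j < d → ψ (sub j root) ≡ suc (toℕ j)
  children = greedyBelow-children h d (below-root (n≤1+n d))
    (λ c _ c≤d c≡p → <⇒≢ (s≤s c≤d) (trans c≡p p≡1+d))
    (λ j d≤j → ⊥-elim (<⇒≱ (toℕ<n j) d≤j))
  fromChildren : SameColoring ψ (withRoot (suc (suc d)))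
  fromChildren root = ψr≡2+d
  fromChildren (sub j w) = greedyBelow-sub-canonical h j (children j (toℕ<n j))
    (≤-trans (toℕ<n j) (<⇒≤ (below-root (n≤1+n d)))) w

-- The coloring obtained from the canonical one by exchanging the two
-- halves root[T_1, …, T_{m}] and T_{m+1} of T_{m+2} = root[T_1, …, T_{m+1}].
swapped : ∀ {m} → Coloring (suc m)
swapped {m} root = suc m
swapped {m} (sub j w) with toℕ j ≟ m
... | yes _ = withRoot (suc (suc m)) w
... | no _ = canonical w

greedy-child-max⇒swapped : ∀ {m} {φ : Coloring (suc m)} → Greedy φ →
                           (i : Fin (suc m)) → φ (sub i root) ≡ suc (suc m) →
                           SameColoring φ swapped
greedy-child-max⇒swapped {m} {φ} h i φi≡2+m = fromParts
  where
  h₀ : GreedyBelow 0 φ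
  h₀ = greedy⇒greedyBelow h
  i≡m : toℕ i ≡ m
  i≡m = ≤-antisym (≤-pred (toℕ<n i))
          (≤-pred (≤-pred (subst (_≤ suc (suc (toℕ i))) φi≡2+m
                            (greedyBelow-root-≤ (greedyBelow-sub h₀ i)))))
  lastSubtree : φ root ≡ suc (toℕ i) ×
                SameColoring (λ w → φ (sub i w)) (withRoot (suc (suc (toℕ i))))
  lastSubtree = greedyBelow-root-max (greedyBelow-sub h₀ i)
                  (trans φi≡2+m (cong (λ t → suc (suc t)) (sym i≡m)))
  φr≡1+m : φ root ≡ suc m
  φr≡1+m = trans (proj₁ lastSubtree) (cong suc i≡m)
  children : ∀ j → toℕ j < m → φ (sub j root) ≡ suc (toℕ j)
  children = greedyBelow-children h₀ m (subst (m <_) (sym φr≡1+m) (n<1+n m))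
                                  (λ _ 1≤c _ → >⇒≢ 1≤c) lastChild
    where
    lastChild : ∀ j → m ≤ toℕ j → m < φ (sub j root)
    lastChild j m≤j
      with toℕ-injective (trans (≤-antisym (≤-pred (toℕ<n j)) m≤j) (sym i≡m))
    ... | refl = subst (m <_) (sym φi≡2+m) (m<n⇒m<1+n ≤-refl)
  fromParts : SameColoring φ swapped
  fromParts root = φr≡1+m
  fromParts (sub j w) with toℕ j ≟ m
  ... | no j≢m = greedyBelow-sub-canonical h₀ j (children j j<m)
                   (subst (_ ≤_) (sym φr≡1+m) (s≤s (<⇒≤ j<m))) w
    where j<m = ≤∧≢⇒< (≤-pred (toℕ<n j)) j≢m
  ... | yes j≡m with toℕ-injective (trans j≡m (sym i≡m))
  ...   | refl =
    trans (proj₂ lastSubtree w) (cong (λ t → withRoot (suc (suc t)) w) i≡m)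

greedy-classification : ∀ {m} {φ : Coloring (suc m)} → Greedy φ → ∀ v → φ v ≡ suc (suc m) →
                        SameColoring φ canonical ⊎ SameColoring φ swapped
greedy-classification h root e = inj₁ (greedy-canonical h e)
greedy-classification h (sub i root) e = inj₂ (greedy-child-max⇒swapped h i e)
greedy-classification h (sub i (sub j w)) e =
  ⊥-elim (<⇒≱ (s≤s (toℕ<n i)) (subst (_≤ suc (toℕ i)) e
    (greedyBelow-sub-≤ (greedyBelow-sub (greedy⇒greedyBelow {p = 0} h) i) j w)))

-- Binary addresses: the subtree of index i occupies [2^i, 2^(i+1)).
address : Vtx (suc d) → ℕ
address root = 0
address (sub i u) = 2 ^ toℕ i + address u

address< : (u : Vtx (suc d)) → address u < 2 ^ d
address-sub< : (i : Fin d) (u : Vtx (suc (toℕ i))) → address (sub i u) < 2 ^ suc (toℕ i)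

address< {d} root = m^n>0 2 d
address< (sub i u) = <-≤-trans (address-sub< i u) (^-monoʳ-≤ 2 (toℕ<n i))

address-sub< i u = <-≤-trans (+-monoʳ-< (2 ^ toℕ i) (address< u))
                     (≤-reflexive (cong (2 ^ toℕ i +_) (sym (+-identityʳ (2 ^ toℕ i)))))

address-sub-<-sub : (i j : Fin d) (u : Vtx (suc (toℕ i))) (v : Vtx (suc (toℕ j))) →
                    toℕ i < toℕ j → address (sub i u) < address (sub j v)
address-sub-<-sub i j u v i<j =
  <-≤-trans (address-sub< i u)
            (≤-trans (^-monoʳ-≤ 2 i<j) (m≤m+n (2 ^ toℕ j) (address v)))

address-injective : (u v : Vtx (suc d)) → address u ≡ address v → u ≡ v
address-injective root root _ = refl
address-injective root (sub j v) e =
  ⊥-elim (<⇒≢ (<-≤-trans (m^n>0 2 (toℕ j)) (m≤m+n (2 ^ toℕ j) (address v))) e)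
address-injective (sub i u) root e =
  ⊥-elim (<⇒≢ (<-≤-trans (m^n>0 2 (toℕ i)) (m≤m+n (2 ^ toℕ i) (address u))) (sym e))
address-injective (sub i u) (sub j v) e with <-cmp (toℕ i) (toℕ j)
... | tri< i<j _ _ = ⊥-elim (<⇒≢ (address-sub-<-sub i j u v i<j) e)
... | tri> _ _ j<i = ⊥-elim (<⇒≢ (address-sub-<-sub j i v u j<i) (sym e))
... | tri≈ _ i≡j _ with toℕ-injective i≡j
...   | refl = cong (sub i) (address-injective u v (+-cancelˡ-≡ (2 ^ toℕ i) _ _ e))

+-*-<-lex : ∀ {a N x y} b → a < N → x < y → a + x * N < b + y * N
+-*-<-lex {a} {N} {x} {y} b a<N x<y =
  <-≤-trans (+-monoˡ-< (x * N) a<N) (≤-trans (*-monoˡ-≤ N x<y) (m≤n+m (y * N) b))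

+-*-injective : ∀ {a b N x y} → a < N → b < N → a + x * N ≡ b + y * N → a ≡ b
+-*-injective {a} {b} {N} {x} {y} a<N b<N e with <-cmp x y
... | tri< x<y _ _ = ⊥-elim (<⇒≢ (+-*-<-lex b a<N x<y) e)
... | tri> _ _ y<x = ⊥-elim (<⇒≢ (+-*-<-lex a b<N y<x) (sym e))
... | tri≈ _ refl _ = +-cancelʳ-≡ (x * N) a b e

greedy⇒firstFit : ∀ {φ : Coloring d} → Greedy φ →
                  ∃ λ (pos : Vtx (suc d) → ℕ) → IsOrdering pos × FirstFit pos φ
greedy⇒firstFit {d} {φ} h = pos , injective , firstFit
  where
  pos : Vtx (suc d) → ℕ
  pos v = address v + φ v * 2 ^ d
  injective : IsOrdering pos
  injective {u} {v} e =
    address-injective u v (+-*-injective {x = φ u} {y = φ v} (address< u) (address< v) e)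
  firstFit : FirstFit pos φ
  firstFit v c 1≤c c<φv with h v c 1≤c c<φv
  ... | x , a , refl = x , a , +-*-<-lex (address v) (address< x) c<φv , refl

greedy⇒grundy : ∀ {c} {φ : Coloring d} → (∀ v → 1 ≤ φ v × φ v ≤ c) →
                Proper φ → Greedy φ → (v : Vtx (suc d)) → φ v ≡ c → Grundy c φ
greedy⇒grundy {c = c} {φ} range proper h v φv≡c =
  (range , surjective) , proper , greedy⇒firstFit h
  where
  surjective : ∀ j → 1 ≤ j → j ≤ c → ∃ λ u → φ u ≡ j
  surjective j 1≤j j≤c with m≤n⇒m<n∨m≡n j≤c
  ... | inj₂ refl = v , φv≡c
  ... | inj₁ j<c with h v j 1≤j (subst (j <_) (sym φv≡c) j<c)
  ...   | x , _ , φx≡j = x , φx≡j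

grundy⇒greedy : ∀ {k c} {φ : Vtx k → ℕ} → Grundy c φ → Greedy φ
grundy⇒greedy (_ , _ , _ , _ , firstFit) v c 1≤c c<φv with firstFit v c 1≤c c<φv
... | x , a , _ , φx≡c = x , a , φx≡c

child-colored : ∀ {c} → 1 ≤ c → c ≤ d → ∃ λ (j : Fin d) → suc (toℕ j) ≡ c
child-colored {c = suc c} _ c<d = fromℕ< c<d , cong suc (toℕ-fromℕ< c<d)

withRoot-range : ∀ {x} → d < x → ∀ v → 1 ≤ withRoot {d} x v × withRoot x v ≤ x
withRoot-range d<x root = <-≤-trans z<s d<x , ≤-refl
withRoot-range d<x (sub j w) with withRoot-range (n<1+n (toℕ j)) w
... | 1≤ , ≤1+j = 1≤ , ≤-trans ≤1+j (≤-trans (toℕ<n j) (<⇒≤ d<x))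

withRoot-proper : ∀ {x} → d < x → Proper (withRoot {d} x)
withRoot-proper d<x _ _ (down {i = j}) x≡1+j = <⇒≢ (≤-<-trans (toℕ<n j) d<x) (sym x≡1+j)
withRoot-proper d<x _ _ (up {i = j}) 1+j≡x = <⇒≢ (≤-<-trans (toℕ<n j) d<x) 1+j≡x
withRoot-proper d<x _ _ (inside {i = j} a) = withRoot-proper (n<1+n (toℕ j)) _ _ a

withRoot-greedy : ∀ {x} → x ≤ suc d → Greedy (withRoot {d} x)
withRoot-greedy x≤1+d root c 1≤c c<x
  with child-colored 1≤c (≤-pred (<-≤-trans c<x x≤1+d))
... | j , 1+j≡c = sub j root , down , 1+j≡c
withRoot-greedy _ (sub j w) c 1≤c c<ψw with withRoot-greedy ≤-refl w c 1≤c c<ψw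
... | x , a , e = sub j x , inside a , e

withRoot-greedyBelow : p ≤ suc d → GreedyBelow p (withRoot {d} (suc p))
withRoot-greedyBelow {d = d} p≤1+d root c 1≤c c<1+p with c ≤? d
... | yes c≤d = inj₁ (sub (proj₁ child) root , down , proj₂ child)
  where child = child-colored 1≤c c≤d
... | no c≰d = inj₂ (refl , ≤-antisym (≤-pred c<1+p) (≤-trans p≤1+d (≰⇒> c≰d)))
withRoot-greedyBelow _ (sub j w) c 1≤c c<ψw with withRoot-greedy ≤-refl w c 1≤c c<ψw
... | x , a , e = inj₁ (sub j x , inside a , e)

canonical-grundy : Grundy (suc d) (canonical {d})
canonical-grundy {d} =
  greedy⇒grundy (withRoot-range (n<1+n d)) (withRoot-proper (n<1+n d)) (withRoot-greedy ≤-refl)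
                root refl

module _ {m : ℕ} where

  swapped-sub : ∀ j w → toℕ j ≢ m → swapped {m} (sub j w) ≡ canonical w
  swapped-sub j w j≢m with toℕ j ≟ m
  ... | yes j≡m = ⊥-elim (j≢m j≡m)
  ... | no _ = refl

  swapped-range : ∀ v → 1 ≤ swapped {m} v × swapped v ≤ suc (suc m)
  swapped-range root = s≤s z≤n , n≤1+n (suc m)
  swapped-range (sub j w) with toℕ j ≟ m
  ... | yes _ = withRoot-range (m<n⇒m<1+n (toℕ<n j)) w
  ... | no _ with withRoot-range (n<1+n (toℕ j)) w
  ...   | 1≤ , ≤1+j = 1≤ , ≤-trans ≤1+j (m≤n⇒m≤1+n (toℕ<n j))

  swapped-proper : Proper (swapped {m})
  swapped-proper _ _ (down {i = j}) with toℕ j ≟ m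
  ... | yes _ = <⇒≢ (n<1+n (suc m))
  ... | no j≢m = λ 1+m≡1+j → j≢m (sym (suc-injective 1+m≡1+j))
  swapped-proper _ _ (up {i = j}) with toℕ j ≟ m
  ... | yes _ = >⇒≢ (n<1+n (suc m))
  ... | no j≢m = λ 1+j≡1+m → j≢m (suc-injective 1+j≡1+m)
  swapped-proper _ _ (inside {i = j} a) with toℕ j ≟ m
  ... | yes _ = withRoot-proper (m<n⇒m<1+n (toℕ<n j)) _ _ a
  ... | no _ = withRoot-proper (n<1+n (toℕ j)) _ _ a

  swapped-greedy : Greedy (swapped {m})
  swapped-greedy = greedy-from-subtrees children subtrees
    where
    children : ∀ c → 1 ≤ c → c < suc m → ∃ λ j → swapped {m} (sub j root) ≡ c
    children c 1≤c c<1+m with child-colored 1≤c (m≤n⇒m≤1+n (≤-pred c<1+m))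
    ... | j , 1+j≡c = j , trans (swapped-sub j root j≢m) 1+j≡c
      where
      j≢m : toℕ j ≢ m
      j≢m j≡m = <⇒≢ c<1+m (trans (sym 1+j≡c) (cong suc j≡m))
    subtrees : ∀ j → GreedyBelow (suc m) (λ w → swapped {m} (sub j w))
    subtrees j with toℕ j ≟ m
    ... | yes j≡m = withRoot-greedyBelow (s≤s (≤-reflexive (sym j≡m)))
    ... | no _ = greedy⇒greedyBelow (withRoot-greedy ≤-refl)

  swapped-grundy : Grundy (suc (suc m)) (swapped {m})
  swapped-grundy =
    greedy⇒grundy swapped-range swapped-proper swapped-greedy (sub (fromℕ m) root) last-colored
    where
    last-colored : swapped (sub (fromℕ m) root) ≡ suc (suc m)
    last-colored with toℕ (fromℕ m) ≟ m
    ... | yes _ = refl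
    ... | no last≢m = ⊥-elim (last≢m (toℕ-fromℕ m))

grundy-≤ : ∀ {c} {φ : Coloring d} → Grundy c φ → c ≤ suc d
grundy-≤ {c = zero} _ = z≤n
grundy-≤ {d} {c = suc c} G@((_ , surjective) , _) with surjective (suc c) (s≤s z≤n) ≤-refl
... | v , φv≡1+c = subst (_≤ suc d) φv≡1+c (greedy-≤ (grundy⇒greedy G) v)

grundy-classification : ∀ {m} {φ : Coloring (suc m)} → Grundy (suc (suc m)) φ →
                        SameColoring φ canonical ⊎ SameColoring φ swapped
grundy-classification G@((_ , surjective) , _) with surjective _ (s≤s z≤n) ≤-refl
... | v , φv≡2+m = greedy-classification (grundy⇒greedy G) v φv≡2+m

lemma1 : ∀ (n : ℕ) →
    GrundyNumberIs (suc n) (suc n) ×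
    (2 ≤ suc n → ExactlyTwo {suc n} (λ φ → Grundy (suc n) φ)) ×
    ExactlyOne {suc n} (λ φ → Grundy (suc n) φ × φ root ≡ suc n)
lemma1 n = ((canonical , canonical-grundy) , λ _ _ → grundy-≤) , exactlyTwo n ,
           (canonical , (canonical-grundy , refl) , rootMax⇒canonical)
  where
  rootMax⇒canonical : ∀ ψ → Grundy (suc n) ψ × ψ root ≡ suc n →
                      SameColoring ψ canonical
  rootMax⇒canonical _ (G , ψr≡1+n) = greedy-canonical (grundy⇒greedy G) ψr≡1+n
  exactlyTwo : ∀ n → 2 ≤ suc n → ExactlyTwo {suc n} (λ φ → Grundy (suc n) φ)
  exactlyTwo zero (s≤s ())
  exactlyTwo (suc m) _ = canonical , swapped , canonical-grundy , swapped-grundy ,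
                         (root , >⇒≢ (n<1+n (suc m))) , λ _ → grundy-classification
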